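{- Let $d\geq 1$ and let $I=\{i_1,\ldots,i_d\}$, $J=\{j_1,\ldots,j_d\}$ with $0\leq i_1<\cdots<i_d$ and $0\leq j_1<\cdots<j_d$ integers. Suppose $J\leq I$. Then \[ b^I_J=\pi^I_J\cdot\sum_{(k_2,\ldots,k_d)\in [i_1-j_1,\,i_2-j_1-1]\times\cdots\times[i_{d-1}-j_1,\,i_d-j_1-1]} b^{\{k_2,\ldots,k_d\}}_{\{j_2-j_1-1,\ldots,j_d-j_1-1\}}. \]
   Context: For integers $p,q\geq 0$, $b_{p,q}=\binom{p}{q}$, with $b_{p,q}=0$ if $q>p$. For finite sets $I=\{i_1<\cdots<i_d\}$ and $J=\{j_1<\cdots<j_d\}$ of non-negative integers, $b^I_J$ denotes the determinant of the $d\times d$ matrix whose $(r,s)$ entry is $b_{i_r,j_s}$ (the determinant of the empty $0\times 0$ matrix is $1$). We write $J\leq I$ if $j_k\leq i_k$ for all $k$. When $J\leq I$, $\pi^I_J=\frac{b_{i_1,j_1}\cdots b_{i_d,j_1}}{b_{j_1,j_1}\cdots b_{j_d,j_1}}$. For integers $k\leq l$, $[k,l]=\{k,k+1,\ldots,l\}$, and $[k,l]=\emptyset$ if $k>l$. Note that for each tuple in the sum, $k_2<k_3<\cdots<k_d$ automatically; when $d=1$ the sum consists of a single term equal to $1$. -}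

module Defs where

open import Data.Nat as ℕ using (ℕ; zero; suc; _∸_; _≤_; _<_)
open import Data.Nat.Combinatorics using (_C_)
open import Data.Fin as Fin using (Fin; punchIn)
import Data.Fin as F
open import Data.Integer as ℤ using (ℤ; +_)
open import Data.List using (List; []; _∷_; map; upTo; foldr)
open import Data.Rational as ℚ using (ℚ)

-- b_{p,q} = binom(p,q)  (stdlib's _C_ is 0 when q > p)
b : ℕ → ℕ → ℕ
b p q = p C q

sumFin : (n : ℕ) → (Fin n → ℤ) → ℤ
sumFin zero    f = + 0
sumFin (suc n) f = f F.zero ℤ.+ sumFin n (λ i → f (F.suc i))

prodFin : (n : ℕ) → (Fin n → ℕ) → ℕ
prodFin zero    f = 1
prodFin (suc n) f = f F.zero ℕ.* prodFin n (λ i → f (F.suc i))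

det : (n : ℕ) → (Fin n → Fin n → ℤ) → ℤ
det zero    M = + 1
det (suc n) M =
  sumFin (suc n) (λ k →
    (sign k) ℤ.* (M F.zero k ℤ.* det n (λ i j → M (F.suc i) (punchIn k j))))
  where
  sign : Fin (suc n) → ℤ
  sign k = (ℤ.- (+ 1)) ℤ.^ F.toℕ k

bDet : (d : ℕ) → (Fin d → ℕ) → (Fin d → ℕ) → ℤ
bDet d I J = det d (λ r s → + b (I r) (J s))

_≤ₜ_ : {d : ℕ} → (Fin d → ℕ) → (Fin d → ℕ) → Set
_≤ₜ_ {d} J I = ∀ (k : Fin d) → J k ≤ I k

StrictInc : {d : ℕ} → (Fin d → ℕ) → Set
StrictInc {d} I = ∀ (r s : Fin d) → r F.< s → I r < I s

-- the integer interval [lo, hi] (empty if lo > hi) as a list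
interval : ℕ → ℕ → List ℕ
interval lo hi = map (lo ℕ.+_) (upTo (suc hi ∸ lo))

sumList : List ℤ → ℤ
sumList = foldr ℤ._+_ (+ 0)

sumBox : (n : ℕ) → (Fin n → ℕ) → (Fin n → ℕ) → ((Fin n → ℕ) → ℤ) → ℤ
sumBox zero    lo hi f = f (λ ())
sumBox (suc n) lo hi f =
  sumList (map (λ k → sumBox n (λ r → lo (F.suc r)) (λ r → hi (F.suc r))
                         (λ ks → f (λ { F.zero → k ; (F.suc r) → ks r })))
               (interval (lo F.zero) (hi F.zero)))

-- π^I_J = (b_{i_1,j_1} ⋯ b_{i_d,j_1}) / (b_{j_1,j_1} ⋯ b_{j_d,j_1}) as a rational;
-- the denominator is nonzero whenever J is increasing (the zero branch is never
-- used under the theorem's hypotheses).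
piIJ : (d : ℕ) → (Fin (suc d) → ℕ) → (Fin (suc d) → ℕ) → ℚ
piIJ d I J with prodFin (suc d) (λ r → b (J r) (J F.zero))
... | zero  = ℚ.0ℚ
... | suc m = (+ prodFin (suc d) (λ r → b (I r) (J F.zero))) ℚ./ suc m

toℚ : ℤ → ℚ
toℚ z = z ℚ./ 1

{-# OPTIONS --safe #-}
-- Put m = j₁. The identity C(k,m)·C(n,k) = C(n,m)·C(n−m,k−m) pulls C(i_r,m) out of row r
-- and C(j_s,m) out of column s of b^I_J, leaving π^I_J times the determinant of
-- (C(i_r−m, j_s−m))_{r,s}. The first column of that matrix consists of ones; subtracting
-- from every row the row above clears it, and by the hockey-stick identity the remaining
-- entries become the interval sums Σ_{k=i_r−m}^{i_{r+1}−m−1} C(k, j_s−m−1). Expanding the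
-- determinant multilinearly in its rows gives the sum over the box.
module Submission where

open import Defs

module LinearFunctional where

  open import Data.Fin using (Fin; zero; suc; toℕ)
  open import Data.Integer using (ℤ; +_; _+_; _*_)
  import Data.Integer.Properties as ℤ
  open import Data.List using (List; []; _∷_; map; applyUpTo; upTo)
  import Data.List.Properties as List
  open import Data.Nat using (ℕ; zero; suc; _∸_)
  import Data.Nat as ℕ
  open import Function using (_∘_; id)
  open import Relation.Binary.PropositionalEquality
  open import Algebra.Properties.CommutativeSemigroup ℤ.+-commutativeSemigroup
    using () renaming (interchange to +-interchange)
  open ≡-Reasoning

  record IsLinear {X : Set} (Φ : (X → ℤ) → ℤ) : Set where
    field
      cong-≗ : ∀ {f g} → f ≗ g → Φ f ≡ Φ g
      +-homo : ∀ f g → Φ (λ x → f x + g x) ≡ Φ f + Φ g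
      *-homo : ∀ c f → Φ (λ x → c * f x) ≡ c * Φ f

    vanishes : ∀ f → (∀ x → f x ≡ + 0) → Φ f ≡ + 0
    vanishes f f≗0 = begin
      Φ f                  ≡⟨ cong-≗ (λ x → trans (f≗0 x) (sym (ℤ.*-zeroˡ (f x)))) ⟩
      Φ (λ x → + 0 * f x)  ≡⟨ *-homo (+ 0) f ⟩
      + 0 * Φ f            ≡⟨ ℤ.*-zeroˡ (Φ f) ⟩
      + 0                  ∎

    sumFin-comm : ∀ n (f : Fin n → X → ℤ) →
                  Φ (λ x → sumFin n (λ j → f j x)) ≡ sumFin n (λ j → Φ (f j))
    sumFin-comm zero    f = vanishes (λ _ → + 0) (λ _ → refl)
    sumFin-comm (suc n) f = begin
        Φ (λ x → f zero x + sumFin n (λ j → f (suc j) x))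
      ≡⟨ +-homo (f zero) _ ⟩
        Φ (f zero) + Φ (λ x → sumFin n (λ j → f (suc j) x))
      ≡⟨ cong (_+_ (Φ (f zero))) (sumFin-comm n (f ∘ suc)) ⟩
        Φ (f zero) + sumFin n (λ j → Φ (f (suc j)))
      ∎

  open IsLinear public

  module _ {X Y : Set} {Φ : (X → ℤ) → ℤ} {Ψ : (Y → ℤ) → ℤ}
           (Φ-linear : IsLinear Φ) (Ψ-linear : IsLinear Ψ) where

    nested-product : ∀ f g → Φ f * Ψ g ≡ Φ (λ x → Ψ (λ y → f x * g y))
    nested-product f g = begin
      Φ f * Ψ g                      ≡⟨ ℤ.*-comm (Φ f) (Ψ g) ⟩
      Ψ g * Φ f                      ≡⟨ *-homo Φ-linear (Ψ g) f ⟨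
      Φ (λ x → Ψ g * f x)            ≡⟨ cong-≗ Φ-linear (λ x → trans (ℤ.*-comm (Ψ g) (f x))
                                                                    (sym (*-homo Ψ-linear (f x) g))) ⟩
      Φ (λ x → Ψ (λ y → f x * g y))  ∎

  sumFin-linear : ∀ n → IsLinear (sumFin n)
  sumFin-linear n = record { cong-≗ = cong-≗′ n ; +-homo = +-homo′ n ; *-homo = *-homo′ n }
    where
    cong-≗′ : ∀ n {f g : Fin n → ℤ} → f ≗ g → sumFin n f ≡ sumFin n g
    cong-≗′ zero    f≗g = refl
    cong-≗′ (suc n) f≗g = cong₂ _+_ (f≗g zero) (cong-≗′ n (f≗g ∘ suc))
    +-homo′ : ∀ n (f g : Fin n → ℤ) → sumFin n (λ x → f x + g x) ≡ sumFin n f + sumFin n g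
    +-homo′ zero    f g = refl
    +-homo′ (suc n) f g = trans (cong (_+_ (f zero + g zero)) (+-homo′ n (f ∘ suc) (g ∘ suc)))
                                (+-interchange (f zero) (g zero) _ _)
    *-homo′ : ∀ n c (f : Fin n → ℤ) → sumFin n (λ x → c * f x) ≡ c * sumFin n f
    *-homo′ zero    c f = sym (ℤ.*-zeroʳ c)
    *-homo′ (suc n) c f = trans (cong (_+_ (c * f zero)) (*-homo′ n c (f ∘ suc)))
                                (sym (ℤ.*-distribˡ-+ c _ _))

  sumList-linear : ∀ {A : Set} (L : List A) → IsLinear (λ f → sumList (map f L))
  sumList-linear L = record { cong-≗ = cong-≗′ L ; +-homo = +-homo′ L ; *-homo = *-homo′ L }
    where
    cong-≗′ : ∀ L {f g} → f ≗ g → sumList (map f L) ≡ sumList (map g L)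
    cong-≗′ L f≗g = cong sumList (List.map-cong f≗g L)
    +-homo′ : ∀ L f g → sumList (map (λ x → f x + g x) L) ≡ sumList (map f L) + sumList (map g L)
    +-homo′ []      f g = refl
    +-homo′ (a ∷ L) f g = trans (cong (_+_ (f a + g a)) (+-homo′ L f g)) (+-interchange (f a) (g a) _ _)
    *-homo′ : ∀ L c f → sumList (map (λ x → c * f x) L) ≡ c * sumList (map f L)
    *-homo′ []      c f = sym (ℤ.*-zeroʳ c)
    *-homo′ (a ∷ L) c f = trans (cong (_+_ (c * f a)) (*-homo′ L c f)) (sym (ℤ.*-distribˡ-+ c _ _))

  sumBox-linear : ∀ n lo hi → IsLinear (sumBox n lo hi)
  sumBox-linear zero    lo hi = record
    { cong-≗ = λ F≗G → F≗G _
    ; +-homo = λ _ _ → refl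
    ; *-homo = λ _ _ → refl
    }
  sumBox-linear (suc n) lo hi = record
    { cong-≗ = λ F≗G → cong-≗ outer (λ k → cong-≗ inner (λ ks → F≗G _))
    ; +-homo = λ F G → trans (cong-≗ outer (λ k → +-homo inner _ _)) (+-homo outer _ _)
    ; *-homo = λ c F → trans (cong-≗ outer (λ k → *-homo inner c _)) (*-homo outer c _)
    }
    where
    outer : IsLinear (λ f → sumList (map f (interval (lo zero) (hi zero))))
    outer = sumList-linear (interval (lo zero) (hi zero))
    inner : IsLinear (sumBox n (lo ∘ suc) (hi ∘ suc))
    inner = sumBox-linear n (lo ∘ suc) (hi ∘ suc)

  sumList-applyUpTo : ∀ (f : ℕ → ℤ) g d →
                      sumList (map f (applyUpTo g d)) ≡ sumFin d (λ i → f (g (toℕ i)))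
  sumList-applyUpTo f g zero    = refl
  sumList-applyUpTo f g (suc d) = cong (_+_ (f (g 0))) (sumList-applyUpTo f (g ∘ suc) d)

  sumList-interval : ∀ (f : ℕ → ℤ) lo hi →
                     sumList (map f (interval lo hi)) ≡ sumFin (suc hi ∸ lo) (λ i → f (lo ℕ.+ toℕ i))
  sumList-interval f lo hi = trans (cong sumList (sym (List.map-∘ (upTo (suc hi ∸ lo)))))
                                   (sumList-applyUpTo (f ∘ (ℕ._+_ lo)) id (suc hi ∸ lo))

module Determinant where

  open import Data.Fin using (Fin; zero; suc; punchIn; inject₁; toℕ)
  open import Data.Integer using (ℤ; +_; _+_; _-_; _*_; _^_; -1ℤ)
  import Data.Integer.Properties as ℤ
  open import Data.Integer.Tactic.RingSolver using (solve-∀)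
  open import Data.List using (map)
  open import Data.Nat using (ℕ; zero; suc)
  import Data.Nat as ℕ
  import Data.Nat.Properties as ℕ
  open import Algebra.Properties.CommutativeSemigroup ℕ.*-commutativeSemigroup
    using (x∙yz≈y∙xz)
  open import Data.Vec.Functional using (_∷_)
  open import Function using (_∘_)
  open import Relation.Binary.PropositionalEquality
  open ≡-Reasoning
  open LinearFunctional

  Matrix : ℕ → Set
  Matrix n = Fin n → Fin n → ℤ

  sign : ∀ {n} → Fin n → ℤ
  sign k = -1ℤ ^ toℕ k

  row₀Minor : ∀ {n} → Matrix (suc n) → Fin (suc n) → Matrix n
  row₀Minor M k i j = M (suc i) (punchIn k j)

  -- det (suc n) M unfolds definitionally to sumFin (suc n) (row₀Term M).
  row₀Term : ∀ {n} → Matrix (suc n) → Fin (suc n) → ℤ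
  row₀Term {n} M k = sign k * (M zero k * det n (row₀Minor M k))

  column₀Minor : ∀ {n} → Matrix (suc n) → Fin (suc n) → Matrix n
  column₀Minor M r i j = M (punchIn r i) (suc j)

  column₀Term : ∀ {n} → Matrix (suc n) → Fin (suc n) → ℤ
  column₀Term {n} M r = sign r * (M r zero * det n (column₀Minor M r))

  private
    cofactor-zeroˡ : ∀ s {a} d → a ≡ + 0 → s * (a * d) ≡ + 0
    cofactor-zeroˡ s d refl = ℤ.*-zeroʳ s

    cofactor-zeroʳ : ∀ s a {d} → d ≡ + 0 → s * (a * d) ≡ + 0
    cofactor-zeroʳ s a refl = trans (cong (s *_) (ℤ.*-zeroʳ a)) (ℤ.*-zeroʳ s)

    regroup : ∀ s a x p d → s * ((a * x) * (p * d)) ≡ (a * p) * (s * (x * d))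
    regroup = solve-∀

  det-cong : ∀ n {M N : Matrix n} → (∀ r s → M r s ≡ N r s) → det n M ≡ det n N
  det-cong zero    M≡N = refl
  det-cong (suc n) M≡N = cong-≗ (sumFin-linear (suc n)) (λ k →
    cong₂ (λ x d → sign k * (x * d)) (M≡N zero k) (det-cong n (λ i j → M≡N (suc i) (punchIn k j))))

  det-row₀-linear : ∀ n (u v : Fin (suc n) → ℤ) c (R : Fin n → Fin (suc n) → ℤ) →
                    det (suc n) ((λ s → u s + c * v s) ∷ R)
                      ≡ det (suc n) (u ∷ R) + c * det (suc n) (v ∷ R)
  det-row₀-linear n u v c R = begin
      det (suc n) ((λ s → u s + c * v s) ∷ R)
    ≡⟨ cong-≗ Σ (λ k → distrib (sign k) (u k) c (v k) (D k)) ⟩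
      sumFin (suc n) (λ k → sign k * (u k * D k) + c * (sign k * (v k * D k)))
    ≡⟨ +-homo Σ (row₀Term (u ∷ R)) (λ k → c * row₀Term (v ∷ R) k) ⟩
      det (suc n) (u ∷ R) + sumFin (suc n) (λ k → c * row₀Term (v ∷ R) k)
    ≡⟨ cong (_+_ (det (suc n) (u ∷ R))) (*-homo Σ c (row₀Term (v ∷ R))) ⟩
      det (suc n) (u ∷ R) + c * det (suc n) (v ∷ R)
    ∎
    where
    Σ : IsLinear (sumFin (suc n))
    Σ = sumFin-linear (suc n)
    D : Fin (suc n) → ℤ
    D k = det n (λ i j → R i (punchIn k j))
    distrib : ∀ s a c b d → s * ((a + c * b) * d) ≡ s * (a * d) + c * (s * (b * d))
    distrib = solve-∀

  det-column₀-expansion : ∀ n (M : Matrix (suc n)) → det (suc n) M ≡ sumFin (suc n) (column₀Term M)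
  det-column₀-expansion zero    M = refl
  det-column₀-expansion (suc n) M = cong (_+_ (row₀Term M zero)) (begin
      sumFin (suc n) (λ k → sign (suc k) * (x k * det (suc n) (row₀Minor M (suc k))))
    ≡⟨ cong-≗ Σ (λ k → cong (λ d → sign (suc k) * (x k * d))
                            (det-column₀-expansion n (row₀Minor M (suc k)))) ⟩
      sumFin (suc n) (λ k → sign (suc k) * (x k * sumFin (suc n) (λ r → sign r * (y r * D k r))))
    ≡⟨ cong-≗ Σ (λ k → scale₂ (sign (suc k)) (x k) (λ r → sign r * (y r * D k r))) ⟩
      sumFin (suc n) (λ k → sumFin (suc n) (λ r → sign (suc k) * (x k * (sign r * (y r * D k r)))))
    ≡⟨ sumFin-comm Σ (suc n) (λ r k → sign (suc k) * (x k * (sign r * (y r * D k r)))) ⟩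
      sumFin (suc n) (λ r → sumFin (suc n) (λ k → sign (suc k) * (x k * (sign r * (y r * D k r)))))
    ≡⟨ cong-≗ Σ (λ r → cong-≗ Σ (λ k → swap-signs (sign k) (sign r) (x k) (y r) (D k r))) ⟩
      sumFin (suc n) (λ r → sumFin (suc n) (λ k → sign (suc r) * (y r * (sign k * (x k * D k r)))))
    ≡⟨ cong-≗ Σ (λ r → scale₂ (sign (suc r)) (y r) (λ k → sign k * (x k * D k r))) ⟨
      sumFin (suc n) (λ r → sign (suc r) * (y r * sumFin (suc n) (λ k → sign k * (x k * D k r))))
    ∎)
    where
    Σ : IsLinear (sumFin (suc n))
    Σ = sumFin-linear (suc n)
    x y : Fin (suc n) → ℤ
    x k = M zero (suc k)
    y r = M (suc r) zero
    D : Fin (suc n) → Fin (suc n) → ℤ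
    D k r = det n (λ i j → M (suc (punchIn r i)) (suc (punchIn k j)))
    scale₂ : ∀ a b f → a * (b * sumFin (suc n) f) ≡ sumFin (suc n) (λ r → a * (b * f r))
    scale₂ a b f = trans (cong (a *_) (sym (*-homo Σ b f))) (sym (*-homo Σ a (λ r → b * f r)))
    swap-signs : ∀ s t a b d → (-1ℤ * s) * (a * (t * (b * d))) ≡ (-1ℤ * t) * (b * (s * (a * d)))
    swap-signs = solve-∀

  equal-rows⇒det≡0 : ∀ n (M : Matrix (suc (suc n))) → (∀ s → M zero s ≡ M (suc zero) s) →
                     det (suc (suc n)) M ≡ + 0

  lower-minor-vanishes : ∀ {n} (M : Matrix (suc (suc n))) → (∀ s → M zero s ≡ M (suc zero) s) →
                         (r : Fin n) → det (suc n) (column₀Minor M (suc (suc r))) ≡ + 0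
  lower-minor-vanishes {suc n} M row₀≡row₁ r =
    equal-rows⇒det≡0 n (column₀Minor M (suc (suc r))) (row₀≡row₁ ∘ suc)

  equal-rows⇒det≡0 n M row₀≡row₁ = begin
      det (suc (suc n)) M
    ≡⟨ det-column₀-expansion (suc n) M ⟩
      column₀Term M zero + (column₀Term M (suc zero) + sumFin n (λ r → column₀Term M (suc (suc r))))
    ≡⟨ cong₂ (λ t u → column₀Term M zero + (t + u)) term₁≡-term₀
             (vanishes (sumFin-linear n) (λ r → column₀Term M (suc (suc r))) lower≡0) ⟩
      column₀Term M zero + (-1ℤ * column₀Term M zero + + 0)
    ≡⟨ cancel (column₀Term M zero) ⟩
      + 0
    ∎
    where
    term₁≡-term₀ : column₀Term M (suc zero) ≡ -1ℤ * column₀Term M zero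
    term₁≡-term₀ = begin
        -1ℤ * (M (suc zero) zero * det (suc n) (column₀Minor M (suc zero)))
      ≡⟨ cong₂ (λ a d → -1ℤ * (a * d)) (sym (row₀≡row₁ zero))
               (det-cong (suc n) {column₀Minor M (suc zero)} {column₀Minor M zero}
                         (λ { zero j → row₀≡row₁ (suc j) ; (suc i) j → refl })) ⟩
        -1ℤ * (M zero zero * det (suc n) (column₀Minor M zero))
      ≡⟨ cong (-1ℤ *_) (ℤ.*-identityˡ _) ⟨
        -1ℤ * column₀Term M zero
      ∎
    lower≡0 : ∀ r → column₀Term M (suc (suc r)) ≡ + 0
    lower≡0 r = cofactor-zeroʳ (sign (suc (suc r))) (M (suc (suc r)) zero)
                               (lower-minor-vanishes M row₀≡row₁ r)
    cancel : ∀ t → t + (-1ℤ * t + + 0) ≡ + 0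
    cancel = solve-∀

  rowDifferences : ∀ {n} → Matrix (suc n) → Matrix (suc n)
  rowDifferences M zero    s = M zero s
  rowDifferences M (suc r) s = M (suc r) s - M (inject₁ r) s

  det-rowDifferences : ∀ n (M : Matrix (suc n)) → det (suc n) (rowDifferences M) ≡ det (suc n) M
  det-rowDifferences zero    M = det-cong 1 {rowDifferences M} {M} (λ { zero s → refl })
  det-rowDifferences (suc n) M = begin
      det (suc (suc n)) (rowDifferences M)
    ≡⟨ cong-≗ Σ (λ k → cong (λ d → sign k * (M zero k * d)) (row₀Minor-rowDifferences k)) ⟩
      sumFin (suc (suc n)) (λ k → sign k * (M zero k * (det (suc n) (row₀Minor M k)
                                                         + -1ℤ * det (suc n) (row₀Minor Z k))))
    ≡⟨ cong-≗ Σ (λ k → distrib (sign k) (M zero k) (det (suc n) (row₀Minor M k))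
                               (det (suc n) (row₀Minor Z k))) ⟩
      sumFin (suc (suc n)) (λ k → row₀Term M k + -1ℤ * row₀Term Z k)
    ≡⟨ +-homo Σ (row₀Term M) (λ k → -1ℤ * row₀Term Z k) ⟩
      det (suc (suc n)) M + sumFin (suc (suc n)) (λ k → -1ℤ * row₀Term Z k)
    ≡⟨ cong (_+_ (det (suc (suc n)) M)) (*-homo Σ -1ℤ (row₀Term Z)) ⟩
      det (suc (suc n)) M + -1ℤ * det (suc (suc n)) Z
    ≡⟨ cong (λ d → det (suc (suc n)) M + -1ℤ * d) (equal-rows⇒det≡0 n Z (λ _ → refl)) ⟩
      det (suc (suc n)) M + -1ℤ * + 0
    ≡⟨ drop-zero (det (suc (suc n)) M) ⟩
      det (suc (suc n)) M
    ∎
    where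
    Σ : IsLinear (sumFin (suc (suc n)))
    Σ = sumFin-linear (suc (suc n))
    R : Fin n → Fin (suc (suc n)) → ℤ
    R i = rowDifferences M (suc (suc i))
    -- The k-th row₀ minor of rowDifferences M is rowDifferences of the k-th row₀ minor of M,
    -- except that its first row also subtracts row 0 of M; summed over k, these extra terms
    -- form the expansion of det Z, whose first two rows coincide.
    Z : Matrix (suc (suc n))
    Z = M zero ∷ (M zero ∷ R)
    row₀Minor-rowDifferences : ∀ k → det (suc n) (row₀Minor (rowDifferences M) k)
                                   ≡ det (suc n) (row₀Minor M k) + -1ℤ * det (suc n) (row₀Minor Z k)
    row₀Minor-rowDifferences k = begin
        det (suc n) (row₀Minor (rowDifferences M) k)
      ≡⟨ det-cong (suc n) {row₀Minor (rowDifferences M) k} {(λ s → u s + -1ℤ * v s) ∷ R′}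
                   (λ { zero    s → cong (_+_ (u s)) (sym (ℤ.-1*i≡-i (v s)))
                             ; (suc i) s → refl }) ⟩
        det (suc n) ((λ s → u s + -1ℤ * v s) ∷ R′)
      ≡⟨ det-row₀-linear n u v -1ℤ R′ ⟩
        det (suc n) (u ∷ R′) + -1ℤ * det (suc n) (v ∷ R′)
      ≡⟨ cong₂ (λ d e → d + -1ℤ * e)
               (trans (det-cong (suc n) {u ∷ R′} {rowDifferences (row₀Minor M k)}
                                (λ { zero s → refl ; (suc i) s → refl }))
                      (det-rowDifferences n (row₀Minor M k)))
               (det-cong (suc n) {v ∷ R′} {row₀Minor Z k} (λ { zero s → refl ; (suc i) s → refl })) ⟩
        det (suc n) (row₀Minor M k) + -1ℤ * det (suc n) (row₀Minor Z k)
      ∎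
      where
      u v : Fin (suc n) → ℤ
      u = M (suc zero) ∘ punchIn k
      v = M zero ∘ punchIn k
      R′ : Fin n → Fin (suc n) → ℤ
      R′ i = R i ∘ punchIn k
    distrib : ∀ s a d e → s * (a * (d + -1ℤ * e)) ≡ s * (a * d) + -1ℤ * (s * (a * e))
    distrib = solve-∀
    drop-zero : ∀ d → d + -1ℤ * + 0 ≡ d
    drop-zero = solve-∀

  det-unit-column₀ : ∀ n (M : Matrix (suc n)) → M zero zero ≡ + 1 → (∀ r → M (suc r) zero ≡ + 0) →
                     det (suc n) M ≡ det n (λ i j → M (suc i) (suc j))
  det-unit-column₀ n M M₀₀≡1 column₀≡0 = begin
      det (suc n) M
    ≡⟨ det-column₀-expansion n M ⟩
      column₀Term M zero + sumFin n (λ r → column₀Term M (suc r))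
    ≡⟨ cong₂ _+_ term₀≡D (vanishes (sumFin-linear n) (λ r → column₀Term M (suc r)) lower≡0) ⟩
      D + + 0
    ≡⟨ ℤ.+-identityʳ D ⟩
      D
    ∎
    where
    D : ℤ
    D = det n (λ i j → M (suc i) (suc j))
    lower≡0 : ∀ r → column₀Term M (suc r) ≡ + 0
    lower≡0 r = cofactor-zeroˡ (sign (suc r)) (det n (column₀Minor M (suc r))) (column₀≡0 r)
    term₀≡D : column₀Term M zero ≡ D
    term₀≡D = trans (ℤ.*-identityˡ (M zero zero * D)) (trans (cong (_* D) M₀₀≡1) (ℤ.*-identityˡ D))

  det-column₀-ones : ∀ n (M : Matrix (suc n)) → (∀ r → M r zero ≡ + 1) →
                     det (suc n) M ≡ det n (λ i j → M (suc i) (suc j) - M (inject₁ i) (suc j))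
  det-column₀-ones n M column₀≡1 = begin
      det (suc n) M
    ≡⟨ det-rowDifferences n M ⟨
      det (suc n) (rowDifferences M)
    ≡⟨ det-unit-column₀ n (rowDifferences M) (column₀≡1 zero)
         (λ r → cong₂ _-_ (column₀≡1 (suc r)) (column₀≡1 (inject₁ r))) ⟩
      det n (λ i j → M (suc i) (suc j) - M (inject₁ i) (suc j))
    ∎

  det-scale-rows : ∀ n (α : Fin n → ℕ) (M : Matrix n) →
                   det n (λ r s → + α r * M r s) ≡ + prodFin n α * det n M
  det-scale-rows zero    α M = refl
  det-scale-rows (suc n) α M = begin
      det (suc n) (λ r s → + α r * M r s)
    ≡⟨ cong-≗ Σ (λ k → cong (λ d → sign k * ((+ α zero * M zero k) * d))
                            (det-scale-rows n (α ∘ suc) (row₀Minor M k))) ⟩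
      sumFin (suc n) (λ k → sign k * ((+ α zero * M zero k) * (+ P * det n (row₀Minor M k))))
    ≡⟨ cong-≗ Σ (λ k → regroup (sign k) (+ α zero) (M zero k) (+ P) (det n (row₀Minor M k))) ⟩
      sumFin (suc n) (λ k → (+ α zero * + P) * row₀Term M k)
    ≡⟨ *-homo Σ (+ α zero * + P) (row₀Term M) ⟩
      (+ α zero * + P) * det (suc n) M
    ≡⟨ cong (_* det (suc n) M) (ℤ.pos-* (α zero) P) ⟨
      + prodFin (suc n) α * det (suc n) M
    ∎
    where
    Σ : IsLinear (sumFin (suc n))
    Σ = sumFin-linear (suc n)
    P : ℕ
    P = prodFin n (α ∘ suc)

  prodFin-punchIn : ∀ n (β : Fin (suc n) → ℕ) k →
                    β k ℕ.* prodFin n (β ∘ punchIn k) ≡ prodFin (suc n) β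
  prodFin-punchIn n       β zero    = refl
  prodFin-punchIn (suc n) β (suc k) =
    trans (x∙yz≈y∙xz (β (suc k)) (β zero) _) (cong (β zero ℕ.*_) (prodFin-punchIn n (β ∘ suc) k))

  det-scale-columns : ∀ n (β : Fin n → ℕ) (M : Matrix n) →
                      det n (λ r s → + β s * M r s) ≡ + prodFin n β * det n M
  det-scale-columns zero    β M = refl
  det-scale-columns (suc n) β M = begin
      det (suc n) (λ r s → + β s * M r s)
    ≡⟨ cong-≗ Σ (λ k → cong (λ d → sign k * ((+ β k * M zero k) * d))
                            (det-scale-columns n (β ∘ punchIn k) (row₀Minor M k))) ⟩
      sumFin (suc n) (λ k → sign k * ((+ β k * M zero k) * (+ P k * det n (row₀Minor M k))))
    ≡⟨ cong-≗ Σ (λ k → regroup (sign k) (+ β k) (M zero k) (+ P k) (det n (row₀Minor M k))) ⟩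
      sumFin (suc n) (λ k → (+ β k * + P k) * row₀Term M k)
    ≡⟨ cong-≗ Σ (λ k → cong (_* row₀Term M k)
                            (trans (sym (ℤ.pos-* (β k) (P k))) (cong +_ (prodFin-punchIn n β k)))) ⟩
      sumFin (suc n) (λ k → + prodFin (suc n) β * row₀Term M k)
    ≡⟨ *-homo Σ (+ prodFin (suc n) β) (row₀Term M) ⟩
      + prodFin (suc n) β * det (suc n) M
    ∎
    where
    Σ : IsLinear (sumFin (suc n))
    Σ = sumFin-linear (suc n)
    P : Fin (suc n) → ℕ
    P k = prodFin n (β ∘ punchIn k)

  det-sum-rows : ∀ n lo hi (g : Fin n → ℕ → Fin n → ℤ) →
                 det n (λ r s → sumList (map (λ k → g r k s) (interval (lo r) (hi r))))
                   ≡ sumBox n lo hi (λ ks → det n (λ r s → g r (ks r) s))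
  det-sum-rows zero    lo hi g = refl
  det-sum-rows (suc n) lo hi g = begin
      det (suc n) (λ r s → sumList (map (λ k → g r k s) (interval (lo r) (hi r))))
    ≡⟨ cong-≗ Σ (λ j → cong (λ d → sign j * (row₀ j * d))
                            (det-sum-rows n (lo ∘ suc) (hi ∘ suc) (λ i k s → g (suc i) k (punchIn j s)))) ⟩
      sumFin (suc n) (λ j → sign j * (row₀ j * sumBox n (lo ∘ suc) (hi ∘ suc) (D j)))
    ≡⟨ cong-≗ Σ (λ j → cong (sign j *_) (nested-product outer inner (λ k → g zero k j) (D j))) ⟩
      sumFin (suc n) (λ j → sign j * sumBox (suc n) lo hi (λ ks → g zero (ks zero) j * D j (ks ∘ suc)))
    ≡⟨ cong-≗ Σ (λ j → *-homo box (sign j) (λ ks → g zero (ks zero) j * D j (ks ∘ suc))) ⟨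
      sumFin (suc n) (λ j → sumBox (suc n) lo hi (λ ks → sign j * (g zero (ks zero) j * D j (ks ∘ suc))))
    ≡⟨ sumFin-comm box (suc n) (λ j ks → sign j * (g zero (ks zero) j * D j (ks ∘ suc))) ⟨
      sumBox (suc n) lo hi (λ ks → det (suc n) (λ r s → g r (ks r) s))
    ∎
    where
    Σ : IsLinear (sumFin (suc n))
    Σ = sumFin-linear (suc n)
    outer : IsLinear (λ f → sumList (map f (interval (lo zero) (hi zero))))
    outer = sumList-linear (interval (lo zero) (hi zero))
    inner : IsLinear (sumBox n (lo ∘ suc) (hi ∘ suc))
    inner = sumBox-linear n (lo ∘ suc) (hi ∘ suc)
    box : IsLinear (sumBox (suc n) lo hi)
    box = sumBox-linear (suc n) lo hi
    row₀ : Fin (suc n) → ℤ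
    row₀ j = sumList (map (λ k → g zero k j) (interval (lo zero) (hi zero)))
    D : Fin (suc n) → (Fin n → ℕ) → ℤ
    D j ks = det n (λ i s → g (suc i) (ks i) (punchIn j s))

module Binomial where

  open import Data.Fin using (toℕ)
  open import Data.Integer as ℤ using (ℤ; +_)
  import Data.Integer.Properties as ℤ
  open import Data.List using (map)
  open import Data.Nat using (ℕ; zero; suc; _+_; _*_; _∸_; _≤_; _<_; _!; NonZero)
  open import Data.Nat.Combinatorics
    using (_C_; nCk≡n!/k![n-k]!; k![n∸k]!∣n!; k>n⇒nCk≡0; nCk+nC[k+1]≡[n+1]C[k+1])
  open import Data.Nat.DivMod using (m/n*n≡m)
  open import Data.Nat.Properties
  import Data.Nat.Tactic.RingSolver as ℕ-Solver
  import Data.Integer.Tactic.RingSolver as ℤ-Solver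
  open import Relation.Binary.PropositionalEquality
  open import Relation.Nullary using (yes; no)
  open ≡-Reasoning
  open LinearFunctional

  nCk*k![n∸k]!≡n! : ∀ {n k} → k ≤ n → (n C k) * (k ! * (n ∸ k) !) ≡ n !
  nCk*k![n∸k]!≡n! {n} {k} k≤n =
    trans (cong (_* (k ! * (n ∸ k) !)) (nCk≡n!/k![n-k]! k≤n))
          (m/n*n≡m {{k !* (n ∸ k) !≢0}} (k![n∸k]!∣n! k≤n))

  nCk≢0 : ∀ {n k} → k ≤ n → NonZero (n C k)
  nCk≢0 {n} {k} k≤n = m*n≢0⇒m≢0 (n C k) {{subst NonZero (sym (nCk*k![n∸k]!≡n! k≤n)) (n !≢0)}}

  kCm*nCk≡nCm*[n∸m]C[k∸m] : ∀ {n k m} → m ≤ k → m ≤ n →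
                            (k C m) * (n C k) ≡ (n C m) * ((n ∸ m) C (k ∸ m))
  kCm*nCk≡nCm*[n∸m]C[k∸m] {n} {k} {m} m≤k m≤n with k ≤? n
  ... | no k≰n = begin
      (k C m) * (n C k)            ≡⟨ cong ((k C m) *_) (k>n⇒nCk≡0 (≰⇒> k≰n)) ⟩
      (k C m) * 0                  ≡⟨ *-zeroʳ (k C m) ⟩
      0                            ≡⟨ *-zeroʳ (n C m) ⟨
      (n C m) * 0                  ≡⟨ cong ((n C m) *_) (k>n⇒nCk≡0 (∸-monoˡ-< (≰⇒> k≰n) m≤n)) ⟨
      (n C m) * ((n ∸ m) C (k ∸ m)) ∎
  ... | yes k≤n = *-cancelʳ-≡ _ _ X {{X≢0}} (trans lhs (sym rhs))
    where
    X : ℕ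
    X = m ! * ((k ∸ m) ! * (n ∸ k) !)
    X≢0 : NonZero X
    X≢0 = m*n≢0 (m !) _ {{m !≢0}} {{(k ∸ m) !* (n ∸ k) !≢0}}
    [n∸m]∸[k∸m]≡n∸k : (n ∸ m) ∸ (k ∸ m) ≡ n ∸ k
    [n∸m]∸[k∸m]≡n∸k = trans (∸-+-assoc n m (k ∸ m)) (cong (n ∸_) (m+[n∸m]≡n m≤k))
    lhs : (k C m) * (n C k) * X ≡ n !
    lhs = begin
        (k C m) * (n C k) * X
      ≡⟨ regroupˡ (k C m) (n C k) (m !) ((k ∸ m) !) ((n ∸ k) !) ⟩
        (n C k) * (((k C m) * (m ! * (k ∸ m) !)) * (n ∸ k) !)
      ≡⟨ cong (λ x → (n C k) * (x * (n ∸ k) !)) (nCk*k![n∸k]!≡n! m≤k) ⟩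
        (n C k) * (k ! * (n ∸ k) !)
      ≡⟨ nCk*k![n∸k]!≡n! k≤n ⟩
        n !
      ∎
      where
      regroupˡ : ∀ a b c d e → a * b * (c * (d * e)) ≡ b * ((a * (c * d)) * e)
      regroupˡ = ℕ-Solver.solve-∀
    rhs : (n C m) * ((n ∸ m) C (k ∸ m)) * X ≡ n !
    rhs = begin
      (n C m) * ((n ∸ m) C (k ∸ m)) * X
        ≡⟨ regroupʳ (n C m) ((n ∸ m) C (k ∸ m)) (m !) ((k ∸ m) !) ((n ∸ k) !) ⟩
      (n C m) * (m ! * (((n ∸ m) C (k ∸ m)) * ((k ∸ m) ! * (n ∸ k) !)))
        ≡⟨ cong (λ x → (n C m) * (m ! * (((n ∸ m) C (k ∸ m)) * ((k ∸ m) ! * x !))))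
                [n∸m]∸[k∸m]≡n∸k ⟨
      (n C m) * (m ! * (((n ∸ m) C (k ∸ m)) * ((k ∸ m) ! * ((n ∸ m) ∸ (k ∸ m)) !)))
        ≡⟨ cong (λ x → (n C m) * (m ! * x)) (nCk*k![n∸k]!≡n! (∸-monoˡ-≤ m k≤n)) ⟩
      (n C m) * (m ! * (n ∸ m) !)
        ≡⟨ nCk*k![n∸k]!≡n! m≤n ⟩
      n !
        ∎
      where
      regroupʳ : ∀ a b c d e → a * b * (c * (d * e)) ≡ a * (c * (b * (d * e)))
      regroupʳ = ℕ-Solver.solve-∀

  hockey-stick : ∀ c a d → + ((a + d) C suc c) ≡ + (a C suc c) ℤ.+ sumFin d (λ i → + ((a + toℕ i) C c))
  hockey-stick c a zero = trans (cong (λ x → + (x C suc c)) (+-identityʳ a)) (sym (ℤ.+-identityʳ _))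
  hockey-stick c a (suc d) = begin
      + ((a + suc d) C suc c)
    ≡⟨ cong (λ x → + (x C suc c)) (+-suc a d) ⟩
      + ((suc a + d) C suc c)
    ≡⟨ hockey-stick c (suc a) d ⟩
      + (suc a C suc c) ℤ.+ sumFin d (λ i → + ((suc a + toℕ i) C c))
    ≡⟨ cong₂ ℤ._+_ (cong +_ (sym (nCk+nC[k+1]≡[n+1]C[k+1] a c)))
                   (cong-≗ (sumFin-linear d) (λ i → cong (λ x → + (x C c)) (sym (+-suc a (toℕ i))))) ⟩
      + (a C c + (a C suc c)) ℤ.+ sumFin d (λ i → + ((a + suc (toℕ i)) C c))
    ≡⟨ cong (ℤ._+ sumFin d (λ i → + ((a + suc (toℕ i)) C c))) (ℤ.pos-+ (a C c) (a C suc c)) ⟩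
      + (a C c) ℤ.+ + (a C suc c) ℤ.+ sumFin d (λ i → + ((a + suc (toℕ i)) C c))
    ≡⟨ swap (+ (a C c)) (+ (a C suc c)) (sumFin d (λ i → + ((a + suc (toℕ i)) C c))) ⟩
      + (a C suc c) ℤ.+ (+ (a C c) ℤ.+ sumFin d (λ i → + ((a + suc (toℕ i)) C c)))
    ≡⟨ cong (λ x → + (a C suc c) ℤ.+ (+ (x C c) ℤ.+ sumFin d (λ i → + ((a + suc (toℕ i)) C c))))
            (sym (+-identityʳ a)) ⟩
      + (a C suc c) ℤ.+ sumFin (suc d) (λ i → + ((a + toℕ i) C c))
    ∎
    where
    swap : ∀ x y z → x ℤ.+ y ℤ.+ z ≡ y ℤ.+ (x ℤ.+ z)
    swap = ℤ-Solver.solve-∀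

  hockey-stick-interval : ∀ c {a b} → a < b →
    + (b C suc c) ℤ.- + (a C suc c) ≡ sumList (map (λ k → + (k C c)) (interval a (b ∸ 1)))
  hockey-stick-interval c {a} {suc b} a<b = begin
      + (suc b C suc c) ℤ.- + (a C suc c)
    ≡⟨ cong (λ x → + (x C suc c) ℤ.- + (a C suc c)) (m+[n∸m]≡n (<⇒≤ a<b)) ⟨
      + ((a + (suc b ∸ a)) C suc c) ℤ.- + (a C suc c)
    ≡⟨ cong (ℤ._- + (a C suc c)) (hockey-stick c a (suc b ∸ a)) ⟩
      + (a C suc c) ℤ.+ Σ ℤ.- + (a C suc c)
    ≡⟨ cancel (+ (a C suc c)) Σ ⟩
      Σ
    ≡⟨ sumList-interval (λ k → + (k C c)) a b ⟨
      sumList (map (λ k → + (k C c)) (interval a b))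
    ∎
    where
    Σ : ℤ
    Σ = sumFin (suc b ∸ a) (λ i → + ((a + toℕ i) C c))
    cancel : ∀ x y → x ℤ.+ y ℤ.- x ≡ y
    cancel = ℤ-Solver.solve-∀

module BinomialDeterminant where

  open import Data.Fin using (Fin; zero; suc; inject₁)
  open import Data.Fin.Properties using (≤̄⇒inject₁<)
  open import Data.Integer as ℤ using (+_; _*_)
  import Data.Integer.Properties as ℤ
  open import Data.List using (map)
  open import Data.Nat using (ℕ; suc; _∸_; _≤_; _<_; s≤s; z≤n)
  open import Data.Nat.Combinatorics using (_C_)
  open import Data.Nat.Properties
    using (≤-refl; ≤-trans; <⇒≤; ∸-monoˡ-<; m<n⇒0<n∸m; m+[n∸m]≡n; n∸n≡0)
  open import Function using (_∘_)
  open import Relation.Binary.PropositionalEquality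
  open ≡-Reasoning
  open Determinant
  open Binomial

  module _ {n} {I : Fin (suc n) → ℕ} (I↑ : StrictInc I) where

    StrictInc⇒zero≤ : ∀ r → I zero ≤ I r
    StrictInc⇒zero≤ zero    = ≤-refl
    StrictInc⇒zero≤ (suc r) = <⇒≤ (I↑ zero (suc r) (s≤s z≤n))

    StrictInc⇒zero<suc : ∀ r → I zero < I (suc r)
    StrictInc⇒zero<suc r = I↑ zero (suc r) (s≤s z≤n)

    StrictInc⇒inject₁<suc : ∀ i → I (inject₁ i) < I (suc i)
    StrictInc⇒inject₁<suc i = I↑ (inject₁ i) (suc i) (≤̄⇒inject₁< ≤-refl)

  bDet-factorization : ∀ n (I J : Fin n → ℕ) m → (∀ r → m ≤ I r) → (∀ s → m ≤ J s) →
    + prodFin n (λ s → b (J s) m) * bDet n I J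
      ≡ + prodFin n (λ r → b (I r) m) * det n (λ r s → + ((I r ∸ m) C (J s ∸ m)))
  bDet-factorization n I J m m≤I m≤J = begin
      + prodFin n β * det n (λ r s → + b (I r) (J s))
    ≡⟨ det-scale-columns n β (λ r s → + b (I r) (J s)) ⟨
      det n (λ r s → + β s * + b (I r) (J s))
    ≡⟨ det-cong n entry ⟩
      det n (λ r s → + α r * + ((I r ∸ m) C (J s ∸ m)))
    ≡⟨ det-scale-rows n α (λ r s → + ((I r ∸ m) C (J s ∸ m))) ⟩
      + prodFin n α * det n (λ r s → + ((I r ∸ m) C (J s ∸ m)))
    ∎
    where
    α β : Fin n → ℕ
    α r = b (I r) m
    β s = b (J s) m
    entry : ∀ r s → + β s * + b (I r) (J s) ≡ + α r * + ((I r ∸ m) C (J s ∸ m))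
    entry r s = trans (sym (ℤ.pos-* (β s) (b (I r) (J s))))
                      (trans (cong +_ (kCm*nCk≡nCm*[n∸m]C[k∸m] (m≤J s) (m≤I r))) (ℤ.pos-* (α r) _))

  det-binomial-sum : ∀ n (a c : Fin (suc n) → ℕ) (e : Fin n → ℕ) →
    (∀ i → a (inject₁ i) < a (suc i)) → c zero ≡ 0 → (∀ j → c (suc j) ≡ suc (e j)) →
    det (suc n) (λ r s → + (a r C c s))
      ≡ sumBox n (a ∘ inject₁) (λ i → a (suc i) ∸ 1) (λ ks → bDet n ks e)
  det-binomial-sum n a c e a↑ c₀≡0 c-suc = begin
      det (suc n) (λ r s → + (a r C c s))
    ≡⟨ det-column₀-ones n (λ r s → + (a r C c s)) (λ r → cong (λ x → + (a r C x)) c₀≡0) ⟩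
      det n (λ i j → + (a (suc i) C c (suc j)) ℤ.- + (a (inject₁ i) C c (suc j)))
    ≡⟨ det-cong n (λ i j → trans (cong (λ x → + (a (suc i) C x) ℤ.- + (a (inject₁ i) C x)) (c-suc j))
                                 (hockey-stick-interval (e j) (a↑ i))) ⟩
      det n (λ i j → sumList (map (λ k → + (k C e j)) (interval (a (inject₁ i)) (a (suc i) ∸ 1))))
    ≡⟨ det-sum-rows n (a ∘ inject₁) (λ i → a (suc i) ∸ 1) (λ i k j → + (k C e j)) ⟩
      sumBox n (a ∘ inject₁) (λ i → a (suc i) ∸ 1) (λ ks → bDet n ks e)
    ∎

  bDet-denominators-cleared : ∀ n (I J : Fin (suc n) → ℕ) → StrictInc I → StrictInc J → J ≤ₜ I →
    + prodFin (suc n) (λ s → b (J s) (J zero)) * bDet (suc n) I J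
      ≡ + prodFin (suc n) (λ r → b (I r) (J zero))
        * sumBox n (λ r → I (inject₁ r) ∸ J zero) (λ r → I (suc r) ∸ J zero ∸ 1)
                   (λ ks → bDet n ks (λ r → J (suc r) ∸ J zero ∸ 1))
  bDet-denominators-cleared n I J I↑ J↑ J≤I = begin
      + prodFin (suc n) (λ s → b (J s) (J zero)) * bDet (suc n) I J
    ≡⟨ bDet-factorization (suc n) I J (J zero) J₀≤I (StrictInc⇒zero≤ J↑) ⟩
      + prodFin (suc n) (λ r → b (I r) (J zero)) * det (suc n) (λ r s → + (a r C c s))
    ≡⟨ cong (+ prodFin (suc n) (λ r → b (I r) (J zero)) *_)
            (det-binomial-sum n a c (λ j → J (suc j) ∸ J zero ∸ 1) a↑ (n∸n≡0 (J zero)) c-suc) ⟩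
      + prodFin (suc n) (λ r → b (I r) (J zero))
        * sumBox n (λ r → I (inject₁ r) ∸ J zero) (λ r → I (suc r) ∸ J zero ∸ 1)
                   (λ ks → bDet n ks (λ r → J (suc r) ∸ J zero ∸ 1))
    ∎
    where
    a c : Fin (suc n) → ℕ
    a r = I r ∸ J zero
    c s = J s ∸ J zero
    J₀≤I : ∀ r → J zero ≤ I r
    J₀≤I r = ≤-trans (J≤I zero) (StrictInc⇒zero≤ I↑ r)
    a↑ : ∀ i → a (inject₁ i) < a (suc i)
    a↑ i = ∸-monoˡ-< (StrictInc⇒inject₁<suc I↑ i) (J₀≤I (inject₁ i))
    c-suc : ∀ j → c (suc j) ≡ suc (c (suc j) ∸ 1)
    c-suc j = sym (m+[n∸m]≡n (m<n⇒0<n∸m (StrictInc⇒zero<suc J↑ j)))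

open import Data.Nat as ℕ using (ℕ; suc; _∸_; NonZero)
open import Data.Nat.Properties using (m*n≢0; *-identityʳ)
open import Data.Fin using (Fin; zero; inject₁)
import Data.Fin as F
open import Data.Integer as ℤ using (ℤ; +_)
open import Data.Rational using (_*_; _/_; toℚᵘ)
open import Data.Rational.Properties using (toℚᵘ-injective; toℚᵘ-fromℚᵘ; toℚᵘ-homo-*)
import Data.Rational.Unnormalised as ℚᵘ
import Data.Rational.Unnormalised.Properties as ℚᵘ
import Data.Integer.Properties as ℤ
open import Relation.Binary.PropositionalEquality using (_≡_; refl; sym; trans; cong; module ≡-Reasoning)
open Binomial using (nCk≢0)
open BinomialDeterminant using (StrictInc⇒zero≤; bDet-denominators-cleared)

prodFin≢0 : ∀ n (f : Fin n → ℕ) → (∀ r → NonZero (f r)) → NonZero (prodFin n f)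
prodFin≢0 ℕ.zero    f f≢0 = _
prodFin≢0 (suc n) f f≢0 =
  m*n≢0 (f zero) _ {{f≢0 zero}} {{prodFin≢0 n (λ r → f (F.suc r)) (λ r → f≢0 (F.suc r))}}

piIJ≡ : ∀ d (I J : Fin (suc d) → ℕ) → .{{_ : NonZero (prodFin (suc d) (λ r → b (J r) (J zero)))}} →
        piIJ d I J ≡ (+ prodFin (suc d) (λ r → b (I r) (J zero))) / prodFin (suc d) (λ r → b (J r) (J zero))
-- The instance rules out the zero branch of piIJ.
piIJ≡ d I J with prodFin (suc d) (λ r → b (J r) (J zero))
... | suc m = refl

toℚ-cancel : ∀ p .{{_ : NonZero p}} (x a y : ℤ) → + p ℤ.* x ≡ a ℤ.* y → toℚ x ≡ (a / p) * toℚ y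
toℚ-cancel (suc m) x a y p*x≡a*y = toℚᵘ-injective (begin
    toℚᵘ (toℚ x)
  ≈⟨ toℚᵘ-fromℚᵘ (ℚᵘ.mkℚᵘ x 0) ⟩
    ℚᵘ.mkℚᵘ x 0
  ≈⟨ ℚᵘ.*≡* cross ⟩
    ℚᵘ.mkℚᵘ a m ℚᵘ.* ℚᵘ.mkℚᵘ y 0
  ≈⟨ ℚᵘ.*-cong (toℚᵘ-fromℚᵘ (ℚᵘ.mkℚᵘ a m)) (toℚᵘ-fromℚᵘ (ℚᵘ.mkℚᵘ y 0)) ⟨
    toℚᵘ (a / suc m) ℚᵘ.* toℚᵘ (toℚ y)
  ≈⟨ toℚᵘ-homo-* (a / suc m) (toℚ y) ⟨
    toℚᵘ ((a / suc m) * toℚ y)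
  ∎)
  where
  open ℚᵘ.≃-Reasoning
  cross : x ℤ.* + suc (m ℕ.* 1) ≡ a ℤ.* y ℤ.* + 1
  cross = trans (cong (λ k → x ℤ.* + suc k) (*-identityʳ m))
         (trans (ℤ.*-comm x (+ suc m)) (trans p*x≡a*y (sym (ℤ.*-identityʳ (a ℤ.* y)))))

theorem2p3 : (n : ℕ) (I J : Fin (suc n) → ℕ) →
    StrictInc I → StrictInc J → J ≤ₜ I →
    toℚ (bDet (suc n) I J)
      ≡ piIJ n I J
        * toℚ (sumBox n
                 (λ r → I (inject₁ r) ∸ J zero)
                 (λ r → I (F.suc r) ∸ J zero ∸ 1)
                 (λ ks → bDet n ks (λ r → J (F.suc r) ∸ J zero ∸ 1)))
theorem2p3 n I J I↑ J↑ J≤I = begin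
    toℚ (bDet (suc n) I J)
  ≡⟨ toℚ-cancel (prodFin (suc n) β) (bDet (suc n) I J) (+ prodFin (suc n) α) S
                (bDet-denominators-cleared n I J I↑ J↑ J≤I) ⟩
    (+ prodFin (suc n) α / prodFin (suc n) β) * toℚ S
  ≡⟨ cong (_* toℚ S) (piIJ≡ n I J) ⟨
    piIJ n I J * toℚ S
  ∎
  where
  open ≡-Reasoning
  α β : Fin (suc n) → ℕ
  α r = b (I r) (J zero)
  β s = b (J s) (J zero)
  S : ℤ
  S = sumBox n (λ r → I (inject₁ r) ∸ J zero) (λ r → I (F.suc r) ∸ J zero ∸ 1)
               (λ ks → bDet n ks (λ r → J (F.suc r) ∸ J zero ∸ 1))
  instance
    β≢0 : NonZero (prodFin (suc n) β)
    β≢0 = prodFin≢0 (suc n) β (λ s → nCk≢0 (StrictInc⇒zero≤ J↑ s))
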